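{- Every function $f:\{0,1\}^{n+2}\to\{0,1\}$ in the support of the distribution $\mathcal{D}_{\mathrm{yes}}$ described below is intersecting, i.e. whenever $f(u)=f(v)=1$ for $u,v\in\{0,1\}^{n+2}$ there is $i\in[n+2]$ with $u_i=v_i=1$.
   Context: Parameters: $n$ and $\varepsilon\in(0,1]$; set $a:=\sqrt{n}/\varepsilon$, $m:=n-a$, $L:=0.1\cdot 2^{\sqrt{m}/\varepsilon}$ (all assumed to be positive integers with $a<n$). For $z\in\{0,1\}^k$ write $|z|$ for its number of ones, $\bar z$ for its bitwise complement, and for $S\subseteq[n]$, $x_S\in\{0,1\}^S$ is the restriction of $x$ to $S$. Define functions on $\{0,1\}^A$ (for any $a$-element set $A$): $g^{(+,0)}\equiv 0$; $g^{(+,1)}(z)=1$ iff $|z|>a/2+\sqrt a$ or $|z|<a/2-\sqrt a$; $g^{(-,0)}(z)=1$ iff $|z|>a/2+\sqrt a$; $g^{(-,1)}(z)=1$ iff $|z|<a/2-\sqrt a$. A draw from $\mathcal{D}_{\mathrm{yes}}$: choose a uniformly random $a$-element set $\mathbf{A}\subseteq[n]$, let $\mathbf{C}=[n]\setminus\mathbf{A}$; draw $\mathbf{T}=(\mathbf{T}_1,\dots,\mathbf{T}_L)$ where each $\mathbf{T}_\ell$ is obtained by drawing $\sqrt{m}/\varepsilon$ elements of $\mathbf{C}$ independently and uniformly with replacement; for $w\in\{0,1\}^{\mathbf{C}}$ let $S_{\mathbf{T}}(w)=\{\ell\in[L]: w_j=1\ \forall j\in\mathbf{T}_\ell\}$;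 draw uniform $\mathbf{b}\in\{0,1\}^L$. For $x\in\{0,1\}^n$ define $f(x,0,0)=f(x,1,1)=0$; $f(x,0,1)=0$ if $|S_{\mathbf{T}}(x_{\mathbf{C}})|\ne1$ and $f(x,0,1)=g^{(+,\mathbf{b}_\ell)}(x_{\mathbf{A}})$ if $S_{\mathbf{T}}(x_{\mathbf{C}})=\{\ell\}$; $f(x,1,0)=0$ if $|S_{\mathbf{T}}(\bar x_{\mathbf{C}})|\ne1$ and $f(x,1,0)=g^{(+,1-\mathbf{b}_\ell)}(x_{\mathbf{A}})$ if $S_{\mathbf{T}}(\bar x_{\mathbf{C}})=\{\ell\}$. -}

module Defs where

open import Data.Bool using (Bool; true; false; _∧_; _∨_; not)
open import Data.Nat using (ℕ; zero; suc; _+_; _*_; _∸_; _<ᵇ_)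
open import Data.Fin using (Fin; zero; suc; _↑ˡ_; _↑ʳ_)
open import Data.Fin.Subset using (Subset)
open import Data.Vec using (Vec; lookup; toList)
open import Data.List using (List; []; _∷_; length; filterᵇ; map; allFin)
open import Data.Bool.ListAction using (and)
open import Data.Product using (∃; _×_)
open import Relation.Binary.PropositionalEquality using (_≡_)

weightOn : ∀ {n} → Subset n → (Fin n → Bool) → ℕ
weightOn {n} A x = length (filterᵇ (λ i → lookup A i ∧ x i) (allFin n))

-- |z| > a/2 + √a   ⇔   2|z| - a > 2√a   ⇔   a < 2|z|  and  4a < (2|z| - a)²
aboveBand : (a w : ℕ) → Bool
aboveBand a w = (a <ᵇ 2 * w) ∧ (4 * a <ᵇ (2 * w ∸ a) * (2 * w ∸ a))

-- |z| < a/2 - √a   ⇔   a - 2|z| > 2√a   ⇔   2|z| < a  and  4a < (a - 2|z|)²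
belowBand : (a w : ℕ) → Bool
belowBand a w = (2 * w <ᵇ a) ∧ (4 * a <ᵇ (a ∸ 2 * w) * (a ∸ 2 * w))

gPlus : ∀ {n} → (a : ℕ) → Bool → Subset n → (Fin n → Bool) → Bool
gPlus a false A x = false
gPlus a true  A x = aboveBand a (weightOn A x) ∨ belowBand a (weightOn A x)

gMinus : ∀ {n} → (a : ℕ) → Bool → Subset n → (Fin n → Bool) → Bool
gMinus a false A x = aboveBand a (weightOn A x)
gMinus a true  A x = belowBand a (weightOn A x)

satisfies : ∀ {n s L} → (Fin L → Vec (Fin n) s) → (Fin n → Bool) → Fin L → Bool
satisfies T w ℓ = and (map w (toList (T ℓ)))

S-T : ∀ {n s L} → (Fin L → Vec (Fin n) s) → (Fin n → Bool) → List (Fin L)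
S-T {L = L} T w = filterᵇ (satisfies T w) (allFin L)

onUnique : ∀ {L} → List (Fin L) → (Fin L → Bool) → Bool
onUnique (ℓ ∷ []) h = h ℓ
onUnique _        h = false

fYes : ∀ {n s L} → (a : ℕ) → Subset n → (Fin L → Vec (Fin n) s) → (Fin L → Bool)
     → (Fin (n + 2) → Bool) → Bool
fYes {n} a A T b u = go (u (n ↑ʳ zero)) (u (n ↑ʳ suc zero))
  where
    x : Fin n → Bool
    x i = u (i ↑ˡ 2)
    go : Bool → Bool → Bool
    go false false = false
    go true  true  = false
    go false true  = onUnique (S-T T x) (λ ℓ → gPlus a (b ℓ) A x)
    go true  false = onUnique (S-T T (λ i → not (x i))) (λ ℓ → gPlus a (not (b ℓ)) A x)

Intersecting : ∀ {k} → ((Fin k → Bool) → Bool) → Set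
Intersecting {k} f = ∀ u v → f u ≡ true → f v ≡ true → ∃ λ (i : Fin k) → (u i ≡ true) × (v i ≡ true)

{-# OPTIONS --safe #-}
module Submission where

open import Defs
open import Data.Bool using (Bool; true; false; not; _≟_; T?)
open import Data.Bool.Properties using (T-≡)
open import Data.Bool.ListAction using (and)
open import Data.Nat using (ℕ; _+_; _*_; _∸_; _^_; _/_; _≤_; _<_)
open import Data.Fin using (Fin; zero; suc; _↑ˡ_; _↑ʳ_)
open import Data.Fin.Subset using (Subset; ∣_∣; _∉_)
open import Data.Fin.Properties using (any?)
open import Data.Vec using (Vec; lookup; toList)
open import Data.List using (List; []; _∷_; map; allFin)
open import Data.List.Membership.Propositional using (_∈_)
open import Data.List.Membership.Propositional.Properties using (∈-filter⁺; ∈-filter⁻; ∈-allFin)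
open import Data.List.Relation.Unary.Any using (here)
open import Data.Product using (∃; _×_; _,_; proj₂)
open import Data.Sum using (_⊎_; inj₁; inj₂)
open import Data.Empty using (⊥-elim)
open import Function using (_∘_)
open import Function.Bundles using (Equivalence)
open import Relation.Nullary using (yes; no; _×-dec_)
open import Relation.Binary.PropositionalEquality using (_≡_; refl; sym; trans; subst)

-- A yes-function is nonzero only on inputs tagged (0,1) or (1,0). Same tags meet on the tag
-- coordinate. For opposite tags, the (0,1)-input x selects the unique clause ℓ satisfied by x,
-- with b_ℓ = 1, and the (1,0)-input y the unique clause ℓ' satisfied by ȳ, with b_ℓ' = 0.
-- If x and y were disjoint then x ≤ ȳ, so ℓ would also be satisfied by ȳ, forcing ℓ = ℓ'.

_⊆ᵇ_ : ∀ {k} → (Fin k → Bool) → (Fin k → Bool) → Set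
w ⊆ᵇ w' = ∀ i → w i ≡ true → w' i ≡ true

and-map-mono : ∀ {A : Set} {p q : A → Bool} → (∀ z → p z ≡ true → q z ≡ true) →
               ∀ zs → and (map p zs) ≡ true → and (map q zs) ≡ true
and-map-mono p⇒q [] _ = refl
and-map-mono {p = p} p⇒q (z ∷ zs) pzs with p z in pz
... | true rewrite p⇒q z pz = and-map-mono p⇒q zs pzs

satisfies-mono : ∀ {n s L} (T : Fin L → Vec (Fin n) s) {w w' : Fin n → Bool} →
                 w ⊆ᵇ w' → ∀ ℓ → satisfies T w ℓ ≡ true → satisfies T w' ℓ ≡ true
satisfies-mono T w⊆w' ℓ = and-map-mono w⊆w' (toList (T ℓ))

∈-S-T⁺ : ∀ {n s L} (T : Fin L → Vec (Fin n) s) w ℓ → satisfies T w ℓ ≡ true → ℓ ∈ S-T T w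
∈-S-T⁺ T w ℓ sat = ∈-filter⁺ (T? ∘ satisfies T w) (∈-allFin ℓ) (Equivalence.from T-≡ sat)

∈-S-T⁻ : ∀ {n s L} (T : Fin L → Vec (Fin n) s) w ℓ → ℓ ∈ S-T T w → satisfies T w ℓ ≡ true
∈-S-T⁻ T w ℓ ℓ∈ = Equivalence.to T-≡ (proj₂ (∈-filter⁻ (T? ∘ satisfies T w) {xs = allFin _} ℓ∈))

S-T-singleton-mono : ∀ {n s L} (T : Fin L → Vec (Fin n) s) {w w' : Fin n → Bool} {ℓ ℓ'} →
                     w ⊆ᵇ w' → S-T T w ≡ ℓ ∷ [] → S-T T w' ≡ ℓ' ∷ [] → ℓ ≡ ℓ'
S-T-singleton-mono T {w} {w'} {ℓ} w⊆w' Sw Sw' with subst (ℓ ∈_) Sw' ℓ∈Sw'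
  where
    ℓ∈Sw' : ℓ ∈ S-T T w'
    ℓ∈Sw' = ∈-S-T⁺ T w' ℓ (satisfies-mono T w⊆w' ℓ (∈-S-T⁻ T w ℓ (subst (ℓ ∈_) (sym Sw) (here refl))))
... | here ℓ≡ℓ' = ℓ≡ℓ'

onUnique-true : ∀ {L} (xs : List (Fin L)) h → onUnique xs h ≡ true →
                ∃ λ ℓ → xs ≡ ℓ ∷ [] × h ℓ ≡ true
onUnique-true (ℓ ∷ []) h hℓ = ℓ , refl , hℓ

gPlus-true : ∀ {n} a c (A : Subset n) x → gPlus a c A x ≡ true → c ≡ true
gPlus-true a true A x _ = refl

module _ {n s L} (a : ℕ) (A : Subset n) (T : Fin L → Vec (Fin n) s) (b : Fin L → Bool) where

  body : (Fin (n + 2) → Bool) → Fin n → Bool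
  body u i = u (i ↑ˡ 2)

  SelectsTrue SelectsFalse : (Fin (n + 2) → Bool) → Set
  SelectsTrue  u = u (n ↑ʳ zero) ≡ false × u (n ↑ʳ suc zero) ≡ true ×
                   ∃ λ ℓ → S-T T (body u) ≡ ℓ ∷ [] × b ℓ ≡ true
  SelectsFalse u = u (n ↑ʳ zero) ≡ true × u (n ↑ʳ suc zero) ≡ false ×
                   ∃ λ ℓ → S-T T (not ∘ body u) ≡ ℓ ∷ [] × b ℓ ≡ false

  fYes-true : ∀ u → fYes a A T b u ≡ true → SelectsTrue u ⊎ SelectsFalse u
  fYes-true u fu with u (n ↑ʳ zero) | u (n ↑ʳ suc zero)
  ... | false | true with onUnique-true (S-T T (body u)) _ fu
  ...   | ℓ , Sℓ , g = inj₁ (refl , refl , ℓ , Sℓ , gPlus-true a (b ℓ) A (body u) g)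
  fYes-true u fu | true | false with onUnique-true (S-T T (not ∘ body u)) _ fu
  ...   | ℓ , Sℓ , g with b ℓ in bℓ | gPlus-true a (not (b ℓ)) A (body u) g
  ...     | false | _  = inj₂ (refl , refl , ℓ , Sℓ , bℓ)
  ...     | true  | ()

  selectsTrue-selectsFalse-meet : ∀ u v → SelectsTrue u → SelectsFalse v →
                                  ∃ λ i → body u i ≡ true × body v i ≡ true
  selectsTrue-selectsFalse-meet u v (_ , _ , ℓ , Sℓ , bℓ) (_ , _ , ℓ' , Sℓ' , bℓ')
    with any? (λ i → (body u i ≟ true) ×-dec (body v i ≟ true))
  ... | yes (i , ui , vi) = i , ui , vi
  ... | no disjoint with trans (sym bℓ) (subst (λ k → b k ≡ false) (sym ℓ≡ℓ') bℓ')
    where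
      u⊆v̄ : body u ⊆ᵇ (not ∘ body v)
      u⊆v̄ i ui with body v i in vi
      ... | false = refl
      ... | true  = ⊥-elim (disjoint (i , ui , vi))
      ℓ≡ℓ' : ℓ ≡ ℓ'
      ℓ≡ℓ' = S-T-singleton-mono T u⊆v̄ Sℓ Sℓ'
  ... | ()

lemma3p1 : (n a m s L : ℕ) →
           0 < a → a < n → n ≤ a * a →
           m ≡ n ∸ a →
           0 < s → s * s * n ≡ m * (a * a) →
           L ≡ (2 ^ s) / 10 → 0 < L →
           (A : Subset n) → ∣ A ∣ ≡ a →
           (T : Fin L → Vec (Fin n) s) → (∀ ℓ j → lookup (T ℓ) j ∉ A) →
           (b : Fin L → Bool) →
           Intersecting (fYes a A T b)
lemma3p1 n a _ _ _ _ _ _ _ _ _ _ _ A _ T _ b u v fu fv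
  with fYes-true a A T b u fu | fYes-true a A T b v fv
... | inj₁ (_ , u₁ , _) | inj₁ (_ , v₁ , _) = n ↑ʳ suc zero , u₁ , v₁
... | inj₂ (u₀ , _) | inj₂ (v₀ , _) = n ↑ʳ zero , u₀ , v₀
... | inj₁ su | inj₂ sv with selectsTrue-selectsFalse-meet a A T b u v su sv
...   | i , ui , vi = i ↑ˡ 2 , ui , vi
lemma3p1 n a _ _ _ _ _ _ _ _ _ _ _ A _ T _ b u v _ _ | inj₂ su | inj₁ sv
  with selectsTrue-selectsFalse-meet a A T b v u sv su
...   | i , vi , ui = i ↑ˡ 2 , ui , vi
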